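{- For every composition $\alpha$, the Young row-strict quasisymmetric Schur function $\mathcal{R}_\alpha$ is a quasisymmetric function.
   Context: Diagrams use the French convention: a composition $\alpha=(\alpha_1,\dots,\alpha_\ell)$ (finite sequence of positive integers) has diagram with $\alpha_i$ left-justified cells in row $i$ from the bottom; cell $(i,j)$ is row $i$ from the bottom, column $j$ from the left. An SSYRT of shape $\alpha$ is a filling $T$ of its diagram with positive integers such that, with $T(i,j)=\infty$ for cells outside the diagram: (1) rows strictly increase left to right; (2) the leftmost column weakly decreases from top to bottom; (3) for $1\le i<j\le\ell(\alpha)$ and $1\le k<m$ ($m$ the largest part), if $T(j,k)<T(i,k+1)$ then $T(j,k+1)\le T(i,k+1)$. Its weight is $x^T=\prod_t x_t^{v_t}$, $v_t$ = number of entries equal to $t$; $\mathcal{R}_\alpha=\sum x^T\in\mathbb{Q}[[x_1,x_2,\dots]]$ over all SSYRT $T$ of shape $\alpha$. A quasisymmetric function is a bounded-degree formal power series $f$ such that for every composition $(\gamma_1,\dots,\gamma_k)$ the coefficient of $x_{i_1}^{\gamma_1}\cdots x_{i_k}^{\gamma_k}$ is the same for all $i_1<\dots<i_k$. -}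

module Defs where

open import Data.Bool using (Bool; true; false; _∧_; _∨_; not; if_then_else_)
open import Data.Nat using (ℕ; zero; suc; _+_; _<_; _≤_; _≡ᵇ_; _<ᵇ_; _≤ᵇ_)
open import Data.Nat.Properties using ()
open import Data.List using (List; []; _∷_; map; concatMap; length; upTo; filterᵇ; foldr; zip)
open import Data.Nat.ListAction using (sum)
open import Data.List.Base using (all)
open import Data.List.Relation.Unary.All using (All)
open import Data.List.Relation.Binary.Pointwise using (Pointwise)
open import Data.Maybe using (Maybe; just; nothing)
open import Data.Product using (Σ; ∃; _×_; _,_)
open import Relation.Binary.PropositionalEquality using (_≡_)

IsComposition : List ℕ → Set
IsComposition α = All (λ a → 0 < a) α

-- Fillings.  A filling of shape α is a list of rows (row 1 = bottom row
-- first), row i being a list of α_i positive integers (left to right).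

Filling : Set
Filling = List (List ℕ)

HasShape : List ℕ → Filling → Set
HasShape α T = map length T ≡ α

range1 : ℕ → List ℕ
range1 N = map suc (upTo N)

-- 1-indexed lookup; nothing means "outside" (value ∞)
nth : {A : Set} → ℕ → List A → Maybe A
nth zero _ = nothing
nth (suc _) [] = nothing
nth (suc zero) (x ∷ _) = just x
nth (suc (suc n)) (_ ∷ xs) = nth (suc n) xs

entry : Filling → ℕ → ℕ → Maybe ℕ
entry T i j with nth i T
... | nothing = nothing
... | just row = nth j row

_<∞_ : Maybe ℕ → Maybe ℕ → Bool
just a <∞ just b = a <ᵇ b
just a <∞ nothing = true
nothing <∞ _ = false

_≤∞_ : Maybe ℕ → Maybe ℕ → Bool
_ ≤∞ nothing = true
just a ≤∞ just b = a ≤ᵇ b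
nothing ≤∞ just _ = false

_⇒ᵇ_ : Bool → Bool → Bool
a ⇒ᵇ b = not a ∨ b

maxList : List ℕ → ℕ
maxList = foldr (λ a b → if a ≤ᵇ b then b else a) 0

strictRow : List ℕ → Bool
strictRow [] = true
strictRow (a ∷ []) = true
strictRow (a ∷ b ∷ r) = (a <ᵇ b) ∧ strictRow (b ∷ r)

cond1 : Filling → Bool
cond1 T = all strictRow T

-- (2) leftmost column weakly decreases from top to bottom:
--     i.e. T(i,1) ≤ T(i+1,1) for 1 ≤ i < ℓ (row 1 is the bottom)
cond2 : List ℕ → Filling → Bool
cond2 α T = all (λ i → entry T i 1 ≤∞ entry T (suc i) 1) (range1 (length α))

cond3 : List ℕ → Filling → Bool
cond3 α T =
  all (λ i → all (λ j → all (λ k →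
        (i <ᵇ j) ⇒ᵇ ((k <ᵇ maxList α) ⇒ᵇ
          ((entry T j k <∞ entry T i (suc k)) ⇒ᵇ
             (entry T j (suc k) ≤∞ entry T i (suc k)))))
      (range1 (maxList α))) (range1 (length α))) (range1 (length α))

isSSYRT : List ℕ → Filling → Bool
isSSYRT α T = cond1 T ∧ cond2 α T ∧ cond3 α T

-- Monomials.  A monomial x_1^{e_1} x_2^{e_2} ... x_n^{e_n} is an exponent
-- list e = (e_1,...,e_n) (trailing zeros allowed; variables beyond n have
-- exponent 0).  Its degree is sum e.

expOf : List ℕ → ℕ → ℕ
expOf e t with nth t e
... | nothing = 0
... | just v = v

countIn : ℕ → Filling → ℕ
countIn t T = sum (map (λ row → length (filterᵇ (λ x → x ≡ᵇ t) row)) T)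

-- T has weight x^e : for every t ≥ 1, #entries equal to t is e_t.
-- (Only t ∈ [1..length e] need checking for fillings with entries in
-- [1..length e], which is all fillings enumerated below.)
hasWeight : List ℕ → Filling → Bool
hasWeight e T = all (λ t → countIn t T ≡ᵇ expOf e t) (range1 (length e))

words : ℕ → ℕ → List (List ℕ)
words zero N = [] ∷ []
words (suc a) N = concatMap (λ x → map (x ∷_) (words a N)) (range1 N)

fillings : List ℕ → ℕ → List Filling
fillings [] N = [] ∷ []
fillings (a ∷ α) N = concatMap (λ r → map (r ∷_) (fillings α N)) (words a N)

-- Coefficient of x^e in R_α : the number of SSYRT of shape α with weight
-- x^e.  Any such T has all entries in [1..length e] (an entry t > length e
-- would force exponent e_t = 0 < #entries equal to t), so enumerating
-- fillings with entries in [1..length e] counts all of them.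
coeffR : List ℕ → List ℕ → ℕ
coeffR α e =
  length (filterᵇ (λ T → isSSYRT α T ∧ hasWeight e T) (fillings α (length e)))

-- Quasisymmetric functions, given by their coefficient function on
-- monomials (exponent lists).

StrictlyIncreasingPos : List ℕ → Set
StrictlyIncreasingPos [] = Data.Unit.⊤ where import Data.Unit
StrictlyIncreasingPos (a ∷ []) = 0 < a
StrictlyIncreasingPos (a ∷ b ∷ r) = 0 < a × a < b × StrictlyIncreasingPos (b ∷ r)

monoExp : List ℕ → List ℕ → ℕ → ℕ
monoExp is γ t = sum (map (λ p → if Data.Product.proj₁ p ≡ᵇ t then Data.Product.proj₂ p else 0) (zip is γ))
  where import Data.Product

monomial : List ℕ → List ℕ → List ℕ
monomial is γ = map (monoExp is γ) (range1 (maxList is))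

degree : List ℕ → ℕ
degree e = sum e

IsQuasisymmetric : (List ℕ → ℕ) → Set
IsQuasisymmetric c =
  (∃ λ d → ∀ e → d < degree e → c e ≡ 0)
  ×
  (∀ γ → IsComposition γ →
   ∀ is js → length is ≡ length γ → length js ≡ length γ →
   StrictlyIncreasingPos is → StrictlyIncreasingPos js →
   c (monomial is γ) ≡ c (monomial js γ))

{-# OPTIONS --safe #-}
module Submission where

open import Defs
open import Data.Bool using (Bool; true; false; _∧_; if_then_else_)
import Data.Bool as Bool
open import Data.Bool.Properties using (T-≡; T-∧; ¬-not)
open import Data.Unit using (tt)
open import Data.Empty using (⊥-elim)
open import Data.Nat using (ℕ; zero; suc; _+_; _<_; _≤_; _≡ᵇ_; _<ᵇ_; _≤ᵇ_; z≤n; s≤s; _≟_; _<?_)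
open import Data.Nat.Properties
open import Data.Nat.ListAction using (sum)
open import Data.List using (List; []; _∷_; map; concatMap; length; filterᵇ; _++_; applyUpTo; cartesianProductWith)
open import Data.List.Base using (all)
open import Data.List.Properties using (length-map; length-++-sucʳ; ∷-injectiveˡ; ∷-injectiveʳ; map-cong; map-∘; map-id; map-cong-local; map-applyUpTo; map-upTo; length-applyUpTo; filter-none; filter-some)
open import Data.List.Membership.Propositional using (_∈_; _∉_)
open import Data.List.Membership.Propositional.Properties
  using (∈-∃++; ∈-++⁻; ∈-++⁺ˡ; ∈-++⁺ʳ; ∈-map⁻; ∈-filter⁺; ∈-filter⁻; ∈-applyUpTo⁺; ∈-upTo⁻; ∈-cartesianProductWith⁺; ∈-cartesianProductWith⁻)
open import Data.List.Membership.DecPropositional _≟_ using (_∈?_)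
open import Data.List.Relation.Binary.Subset.Propositional using (_⊆_)
open import Data.List.Relation.Unary.Any using (Any; here; there)
import Data.List.Relation.Unary.Any as Any
open import Data.List.Relation.Unary.All using (All; []; _∷_)
import Data.List.Relation.Unary.All as All
import Data.List.Relation.Unary.All.Properties as All
open import Data.List.Relation.Unary.Unique.Propositional using (Unique)
import Data.List.Relation.Unary.Unique.Propositional.Properties as Unique
open import Data.List.Relation.Unary.AllPairs using ([]; _∷_)
open import Data.Maybe using (just; nothing; fromMaybe)
import Data.Maybe as Maybe
import Data.Maybe.Relation.Unary.All as MaybeAll
open import Data.Product using (_×_; _,_; ∃₂)
open import Data.Sum using (inj₁; inj₂)
open import Function using (_∘_; _⇔_; mk⇔; Equivalence)
open import Relation.Nullary using (yes; no)
open import Relation.Nullary.Decidable using (T?)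
open import Relation.Binary using (tri<; tri≈; tri>)
open import Relation.Binary.PropositionalEquality
open import Algebra.Properties.CommutativeSemigroup +-commutativeSemigroup using (interchange)

-- An SSYRT of shape α has |α| cells, so every monomial in R_α has degree |α|.
-- For i₁ < ⋯ < i_k and j₁ < ⋯ < j_k, the relabelling i_r ↦ j_r is strictly increasing on
-- {i₁, …, i_k}.  The three SSYRT conditions only compare entries with each other (and with ∞),
-- so the relabelling maps the SSYRTs of weight x_{i₁}^{γ₁} ⋯ x_{i_k}^{γ_k} injectively to those
-- of weight x_{j₁}^{γ₁} ⋯ x_{j_k}^{γ_k}; doing the same in the other direction makes the two
-- coefficients equal.

T-⇔⇒≡ : ∀ {b c} → Bool.T b ⇔ Bool.T c → b ≡ c
T-⇔⇒≡ {false} {false} _ = refl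
T-⇔⇒≡ {false} {true}  b⇔c = ⊥-elim (Equivalence.from b⇔c tt)
T-⇔⇒≡ {true}  {false} b⇔c = ⊥-elim (Equivalence.to b⇔c tt)
T-⇔⇒≡ {true}  {true}  _ = refl

≡ᵇ-refl : ∀ n → (n ≡ᵇ n) ≡ true
≡ᵇ-refl n = Equivalence.to T-≡ (≡⇒≡ᵇ n n refl)

≢⇒≡ᵇ-false : ∀ {m n} → m ≢ n → (m ≡ᵇ n) ≡ false
≢⇒≡ᵇ-false {m} {n} m≢n = ¬-not (m≢n ∘ ≡ᵇ⇒≡ m n ∘ Equivalence.from T-≡)

all-cong : ∀ {A : Set} {p q : A → Bool} (xs : List A) → (∀ x → p x ≡ q x) → all p xs ≡ all q xs
all-cong []       p≗q = refl
all-cong (x ∷ xs) p≗q = cong₂ _∧_ (p≗q x) (all-cong xs p≗q)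

indicator : Bool → ℕ
indicator b = if b then 1 else 0

length-filterᵇ-∷ : ∀ {A : Set} (p : A → Bool) x xs →
  length (filterᵇ p (x ∷ xs)) ≡ indicator (p x) + length (filterᵇ p xs)
length-filterᵇ-∷ p x xs with p x
... | true  = refl
... | false = refl

Unique-⊆⇒length≤ : ∀ {A : Set} {xs ys : List A} → Unique xs → xs ⊆ ys → length xs ≤ length ys
Unique-⊆⇒length≤ {xs = []}     _            _     = z≤n
Unique-⊆⇒length≤ {xs = x ∷ xs} (x∉xs ∷ !xs) xs⊆ys with ∈-∃++ (xs⊆ys (here refl))
... | us , vs , refl = subst (suc (length xs) ≤_) (sym (length-++-sucʳ us x vs))
                             (s≤s (Unique-⊆⇒length≤ !xs xs⊆us++vs))
  where
  xs⊆us++vs : xs ⊆ us ++ vs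
  xs⊆us++vs {y} y∈xs with ∈-++⁻ us (xs⊆ys (there y∈xs))
  ... | inj₁ y∈us         = ∈-++⁺ˡ y∈us
  ... | inj₂ (here refl)  = ⊥-elim (All.lookup x∉xs y∈xs refl)
  ... | inj₂ (there y∈vs) = ∈-++⁺ʳ us y∈vs

map⁺-injectiveOn : ∀ {A B : Set} (f : A → B) {xs : List A} →
  (∀ {x y} → x ∈ xs → y ∈ xs → f x ≡ f y → x ≡ y) → Unique xs → Unique (map f xs)
map⁺-injectiveOn f {[]}     _   []            = []
map⁺-injectiveOn f {x ∷ xs} inj (x∉xs ∷ !xs) =
  All.map⁺ (All.tabulate (λ y∈xs fx≡fy → All.lookup x∉xs y∈xs (inj (here refl) (there y∈xs) fx≡fy)))
  ∷ map⁺-injectiveOn f (λ x∈ y∈ → inj (there x∈) (there y∈)) !xs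

length-≤-retraction : ∀ {A B : Set} {xs : List A} {ys : List B} (f : A → B) (g : B → A) → Unique xs →
  (∀ {x} → x ∈ xs → f x ∈ ys) → (∀ {x} → x ∈ xs → g (f x) ≡ x) → length xs ≤ length ys
length-≤-retraction {xs = xs} {ys} f g !xs f∈ys gf≡id =
  subst (_≤ _) (length-map f xs) (Unique-⊆⇒length≤ (map⁺-injectiveOn f injective !xs) f[xs]⊆ys)
  where
  injective : ∀ {x y} → x ∈ xs → y ∈ xs → f x ≡ f y → x ≡ y
  injective x∈ y∈ fx≡fy = trans (sym (gf≡id x∈)) (trans (cong g fx≡fy) (gf≡id y∈))
  f[xs]⊆ys : map f xs ⊆ ys
  f[xs]⊆ys z∈ with ∈-map⁻ f z∈
  ... | x , x∈ , refl = f∈ys x∈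

consProduct : {A : Set} → List A → List (List A) → List (List A)
consProduct xs wss = concatMap (λ x → map (x ∷_) wss) xs

consProduct≡cartesianProductWith : ∀ {A : Set} (xs : List A) wss →
  consProduct xs wss ≡ cartesianProductWith _∷_ xs wss
consProduct≡cartesianProductWith []       wss = refl
consProduct≡cartesianProductWith (x ∷ xs) wss = cong (map (x ∷_) wss ++_) (consProduct≡cartesianProductWith xs wss)

∈-consProduct⁺ : ∀ {A : Set} {xs : List A} {wss x ws} → x ∈ xs → ws ∈ wss → x ∷ ws ∈ consProduct xs wss
∈-consProduct⁺ {xs = xs} {wss} x∈ ws∈ =
  subst (_ ∈_) (sym (consProduct≡cartesianProductWith xs wss)) (∈-cartesianProductWith⁺ _∷_ x∈ ws∈)

∈-consProduct⁻ : ∀ {A : Set} (xs : List A) wss {vs} → vs ∈ consProduct xs wss →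
  ∃₂ λ x ws → x ∈ xs × ws ∈ wss × vs ≡ x ∷ ws
∈-consProduct⁻ xs wss vs∈ =
  ∈-cartesianProductWith⁻ _∷_ xs wss (subst (_ ∈_) (consProduct≡cartesianProductWith xs wss) vs∈)

consProduct-Unique : ∀ {A : Set} {xs : List A} {wss} → Unique xs → Unique wss → Unique (consProduct xs wss)
consProduct-Unique {xs = xs} {wss} !xs !wss =
  subst Unique (sym (consProduct≡cartesianProductWith xs wss))
    (Unique.cartesianProductWith⁺ _∷_ (λ e → ∷-injectiveˡ e , ∷-injectiveʳ e) !xs !wss)

range1≡applyUpTo : ∀ N → range1 N ≡ applyUpTo suc N
range1≡applyUpTo = map-upTo suc

∈-range1⁺ : ∀ {N t} → t < N → suc t ∈ range1 N
∈-range1⁺ {N} t<N = subst (_ ∈_) (sym (range1≡applyUpTo N)) (∈-applyUpTo⁺ suc t<N)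

∈-range1⁻ : ∀ {N t} → suc t ∈ range1 N → t < N
∈-range1⁻ st∈ with ∈-map⁻ suc st∈
... | _ , t∈ , refl = ∈-upTo⁻ t∈

0∉range1 : ∀ N → 0 ∉ range1 N
0∉range1 N 0∈ with ∈-map⁻ suc 0∈
... | _ , _ , ()

length-range1 : ∀ N → length (range1 N) ≡ N
length-range1 N = trans (cong length (range1≡applyUpTo N)) (length-applyUpTo suc N)

range1-Unique : ∀ N → Unique (range1 N)
range1-Unique N = Unique.map⁺ suc-injective (Unique.upTo⁺ N)

words-Unique : ∀ a N → Unique (words a N)
words-Unique zero    N = [] ∷ []
words-Unique (suc a) N = consProduct-Unique (range1-Unique N) (words-Unique a N)

fillings-Unique : ∀ α N → Unique (fillings α N)
fillings-Unique []      N = [] ∷ []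
fillings-Unique (a ∷ α) N = consProduct-Unique (words-Unique a N) (fillings-Unique α N)

∈-words⁺ : ∀ a N {w} → length w ≡ a → All (_∈ range1 N) w → w ∈ words a N
∈-words⁺ zero    N {[]}    refl []          = here refl
∈-words⁺ (suc a) N {x ∷ w} |w|  (x∈ ∷ w∈) = ∈-consProduct⁺ x∈ (∈-words⁺ a N (suc-injective |w|) w∈)

∈-words⁻ : ∀ a N {w} → w ∈ words a N → length w ≡ a × All (_∈ range1 N) w
∈-words⁻ zero    N (here refl) = refl , []
∈-words⁻ (suc a) N w∈ with ∈-consProduct⁻ (range1 N) (words a N) w∈
... | x , w , x∈ , w∈words , refl = let |w| , w∈range = ∈-words⁻ a N w∈words in cong suc |w| , x∈ ∷ w∈range

∈-fillings⁺ : ∀ α N {T} → HasShape α T → All (All (_∈ range1 N)) T → T ∈ fillings α N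
∈-fillings⁺ []      N {[]}     refl  []            = here refl
∈-fillings⁺ (a ∷ α) N {r ∷ T} shape (r∈ ∷ T∈) =
  ∈-consProduct⁺ (∈-words⁺ a N (∷-injectiveˡ shape) r∈) (∈-fillings⁺ α N (∷-injectiveʳ shape) T∈)

∈-fillings⁻ : ∀ α N {T} → T ∈ fillings α N → HasShape α T × All (All (_∈ range1 N)) T
∈-fillings⁻ []      N (here refl) = refl , []
∈-fillings⁻ (a ∷ α) N T∈ with ∈-consProduct⁻ (words a N) (fillings α N) T∈
... | r , T , r∈ , T∈fillings , refl =
  let |r| , r∈range = ∈-words⁻ a N r∈ ; shape , T∈range = ∈-fillings⁻ α N T∈fillings
  in cong₂ _∷_ |r| shape , r∈range ∷ T∈range

-- Order isomorphisms between strictly increasing lists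

Increasing-tail : ∀ {i is} → StrictlyIncreasingPos (i ∷ is) → StrictlyIncreasingPos is
Increasing-tail {is = []}    _           = tt
Increasing-tail {is = _ ∷ _} (_ , _ , ↑) = ↑

Increasing-head< : ∀ {i is} → StrictlyIncreasingPos (i ∷ is) → All (i <_) is
Increasing-head< {is = []}    _             = []
Increasing-head< {is = _ ∷ _} (_ , i<b , ↑) = i<b ∷ All.map (<-trans i<b) (Increasing-head< ↑)

Increasing-positive : ∀ {is} → StrictlyIncreasingPos is → ∀ {t} → t ∈ is → 0 < t
Increasing-positive {_ ∷ []}    0<i         (here refl) = 0<i
Increasing-positive {_ ∷ _ ∷ _} (0<i , _)   (here refl) = 0<i
Increasing-positive ↑                       (there t∈)  = Increasing-positive (Increasing-tail ↑) t∈

Increasing-tail-≢ : ∀ {i is t} → StrictlyIncreasingPos (i ∷ is) → t ∈ is → t ≢ i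
Increasing-tail-≢ ↑ t∈ refl = <-irrefl refl (All.lookup (Increasing-head< ↑) t∈)

Increasing-head∉ : ∀ {i is} → StrictlyIncreasingPos (i ∷ is) → i ∉ is
Increasing-head∉ ↑ i∈ = Increasing-tail-≢ ↑ i∈ refl

∈⇒≤maxList : ∀ {x} xs → x ∈ xs → x ≤ maxList xs
∈⇒≤maxList (a ∷ xs) x∈ with a ≤ᵇ maxList xs in eq | x∈
... | true  | here refl   = ≤ᵇ⇒≤ a (maxList xs) (subst Bool.T (sym eq) tt)
... | true  | there x∈xs = ∈⇒≤maxList xs x∈xs
... | false | here refl   = ≤-refl
... | false | there x∈xs = ≤-trans (∈⇒≤maxList xs x∈xs) (<⇒≤ (≰⇒> (λ a≤ → subst Bool.T eq (≤⇒≤ᵇ a≤))))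

Increasing-⊆-range1 : ∀ {is} → StrictlyIncreasingPos is → is ⊆ range1 (maxList is)
Increasing-⊆-range1 {is} ↑ {suc t} t∈ = ∈-range1⁺ (∈⇒≤maxList is t∈)
Increasing-⊆-range1      ↑ {zero}  t∈ = ⊥-elim (<-irrefl refl (Increasing-positive ↑ t∈))

reindex : List ℕ → List ℕ → ℕ → ℕ
reindex (i ∷ is) (j ∷ js) t with t ≟ i
... | yes _ = j
... | no  _ = reindex is js t
reindex _ _ t = t

reindex-head : ∀ i is j js → reindex (i ∷ is) (j ∷ js) i ≡ j
reindex-head i is j js with i ≟ i
... | yes _   = refl
... | no  i≢i = ⊥-elim (i≢i refl)

reindex-tail : ∀ {i is j js t} → t ≢ i → reindex (i ∷ is) (j ∷ js) t ≡ reindex is js t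
reindex-tail {i} {t = t} t≢i with t ≟ i
... | yes t≡i = ⊥-elim (t≢i t≡i)
... | no  _   = refl

reindex-∈ : ∀ is js → length is ≡ length js → StrictlyIncreasingPos is →
  ∀ {t} → t ∈ is → reindex is js t ∈ js
reindex-∈ (i ∷ is) (j ∷ js) _ _ (here refl) = subst (_∈ j ∷ js) (sym (reindex-head i is j js)) (here refl)
reindex-∈ (i ∷ is) (j ∷ js) |is| ↑ (there t∈) =
  subst (_∈ j ∷ js) (sym (reindex-tail (Increasing-tail-≢ ↑ t∈)))
    (there (reindex-∈ is js (suc-injective |is|) (Increasing-tail ↑) t∈))

reindex-inverse : ∀ is js → length is ≡ length js → StrictlyIncreasingPos is → StrictlyIncreasingPos js →
  ∀ {t} → t ∈ is → reindex js is (reindex is js t) ≡ t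
reindex-inverse (i ∷ is) (j ∷ js) _ _ _ (here refl) =
  trans (cong (reindex (j ∷ js) (i ∷ is)) (reindex-head i is j js)) (reindex-head j js i is)
reindex-inverse (i ∷ is) (j ∷ js) |is| is↑ js↑ {t} (there t∈) = begin
  reindex (j ∷ js) (i ∷ is) (reindex (i ∷ is) (j ∷ js) t) ≡⟨ cong (reindex (j ∷ js) (i ∷ is)) (reindex-tail (Increasing-tail-≢ is↑ t∈)) ⟩
  reindex (j ∷ js) (i ∷ is) (reindex is js t)             ≡⟨ reindex-tail (Increasing-tail-≢ js↑ (reindex-∈ is js |is|′ (Increasing-tail is↑) t∈)) ⟩
  reindex js is (reindex is js t)                         ≡⟨ reindex-inverse is js |is|′ (Increasing-tail is↑) (Increasing-tail js↑) t∈ ⟩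
  t                                                       ∎
  where open ≡-Reasoning
        |is|′ : length is ≡ length js
        |is|′ = suc-injective |is|

reindex-mono : ∀ is js → length is ≡ length js → StrictlyIncreasingPos is → StrictlyIncreasingPos js →
  ∀ {a b} → a ∈ is → b ∈ is → a < b → reindex is js a < reindex is js b
reindex-mono (i ∷ is) (j ∷ js) _ _ _ (here refl) (here refl) a<a = ⊥-elim (<-irrefl refl a<a)
reindex-mono (i ∷ is) (j ∷ js) |is| is↑ js↑ (here refl) (there b∈) _ =
  subst₂ _<_ (sym (reindex-head i is j js)) (sym (reindex-tail (Increasing-tail-≢ is↑ b∈)))
    (All.lookup (Increasing-head< js↑) (reindex-∈ is js (suc-injective |is|) (Increasing-tail is↑) b∈))
reindex-mono (i ∷ is) (j ∷ js) _ is↑ _ (there a∈) (here refl) a<i =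
  ⊥-elim (<-asym a<i (All.lookup (Increasing-head< is↑) a∈))
reindex-mono (i ∷ is) (j ∷ js) |is| is↑ js↑ (there a∈) (there b∈) a<b =
  subst₂ _<_ (sym (reindex-tail (Increasing-tail-≢ is↑ a∈))) (sym (reindex-tail (Increasing-tail-≢ is↑ b∈)))
    (reindex-mono is js (suc-injective |is|) (Increasing-tail is↑) (Increasing-tail js↑) a∈ b∈ a<b)

-- Relabelling fillings by a strictly monotone map

module StrictlyMonotoneOn {G : ℕ → Set} {φ : ℕ → ℕ}
  (φ-mono : ∀ {a b} → G a → G b → a < b → φ a < φ b) where

  <-reflected : ∀ {a b} → G a → G b → φ a < φ b → a < b
  <-reflected {a} {b} ga gb φa<φb with <-cmp a b
  ... | tri< a<b _ _  = a<b
  ... | tri≈ _ refl _ = ⊥-elim (<-irrefl refl φa<φb)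
  ... | tri> _ _ b<a  = ⊥-elim (<-asym φa<φb (φ-mono gb ga b<a))

  ≤-preserved : ∀ {a b} → G a → G b → a ≤ b → φ a ≤ φ b
  ≤-preserved ga gb a≤b = ≮⇒≥ (λ φb<φa → <⇒≱ (<-reflected gb ga φb<φa) a≤b)

  ≤-reflected : ∀ {a b} → G a → G b → φ a ≤ φ b → a ≤ b
  ≤-reflected ga gb φa≤φb = ≮⇒≥ (λ b<a → <⇒≱ (φ-mono gb ga b<a) φa≤φb)

  injective : ∀ {a b} → G a → G b → φ a ≡ φ b → a ≡ b
  injective ga gb φa≡φb = ≤-antisym (≤-reflected ga gb (≤-reflexive φa≡φb)) (≤-reflected gb ga (≤-reflexive (sym φa≡φb)))

  <ᵇ-preserved : ∀ {a b} → G a → G b → (φ a <ᵇ φ b) ≡ (a <ᵇ b)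
  <ᵇ-preserved {a} {b} ga gb = T-⇔⇒≡ (mk⇔ (<⇒<ᵇ ∘ <-reflected ga gb ∘ <ᵇ⇒< (φ a) (φ b)) (<⇒<ᵇ ∘ φ-mono ga gb ∘ <ᵇ⇒< a b))

  ≤ᵇ-preserved : ∀ {a b} → G a → G b → (φ a ≤ᵇ φ b) ≡ (a ≤ᵇ b)
  ≤ᵇ-preserved {a} {b} ga gb = T-⇔⇒≡ (mk⇔ (≤⇒≤ᵇ ∘ ≤-reflected ga gb ∘ ≤ᵇ⇒≤ (φ a) (φ b)) (≤⇒≤ᵇ ∘ ≤-preserved ga gb ∘ ≤ᵇ⇒≤ a b))

  ≡ᵇ-preserved : ∀ {a b} → G a → G b → (φ a ≡ᵇ φ b) ≡ (a ≡ᵇ b)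
  ≡ᵇ-preserved {a} {b} ga gb = T-⇔⇒≡ (mk⇔ (≡⇒≡ᵇ a b ∘ injective ga gb ∘ ≡ᵇ⇒≡ (φ a) (φ b)) (≡⇒≡ᵇ (φ a) (φ b) ∘ cong φ ∘ ≡ᵇ⇒≡ a b))

  <∞-preserved : ∀ {a b} → MaybeAll.All G a → MaybeAll.All G b → (Maybe.map φ a <∞ Maybe.map φ b) ≡ (a <∞ b)
  <∞-preserved (MaybeAll.just ga) (MaybeAll.just gb) = <ᵇ-preserved ga gb
  <∞-preserved (MaybeAll.just _)  MaybeAll.nothing   = refl
  <∞-preserved MaybeAll.nothing   _                  = refl

  ≤∞-preserved : ∀ {a b} → MaybeAll.All G a → MaybeAll.All G b → (Maybe.map φ a ≤∞ Maybe.map φ b) ≡ (a ≤∞ b)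
  ≤∞-preserved (MaybeAll.just ga) (MaybeAll.just gb) = ≤ᵇ-preserved ga gb
  ≤∞-preserved _                  MaybeAll.nothing   = refl
  ≤∞-preserved MaybeAll.nothing   (MaybeAll.just _)  = refl

relabel : (ℕ → ℕ) → Filling → Filling
relabel φ = map (map φ)

relabel-HasShape : ∀ φ {α} T → HasShape α T → HasShape α (relabel φ T)
relabel-HasShape φ T shape = trans (sym (map-∘ T)) (trans (map-cong (length-map φ) T) shape)

relabel-inverse : ∀ {P : ℕ → Set} φ ψ → (∀ {x} → P x → ψ (φ x) ≡ x) → ∀ {T} → All (All P) T → relabel ψ (relabel φ T) ≡ T
relabel-inverse φ ψ ψφ≡id []                = refl
relabel-inverse φ ψ ψφ≡id {r ∷ T} (r∈P ∷ T∈P) =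
  cong₂ _∷_ (trans (sym (map-∘ r)) (trans (map-cong-local (All.map ψφ≡id r∈P)) (map-id r))) (relabel-inverse φ ψ ψφ≡id T∈P)

nth-map : ∀ {A B : Set} (f : A → B) i (xs : List A) → nth i (map f xs) ≡ Maybe.map f (nth i xs)
nth-map f zero          xs       = refl
nth-map f (suc i)       []       = refl
nth-map f (suc zero)    (x ∷ xs) = refl
nth-map f (suc (suc i)) (x ∷ xs) = nth-map f (suc i) xs

nth-All : ∀ {A : Set} {P : A → Set} i {xs} → All P xs → MaybeAll.All P (nth i xs)
nth-All zero          _          = MaybeAll.nothing
nth-All (suc i)       []         = MaybeAll.nothing
nth-All (suc zero)    (px ∷ _)   = MaybeAll.just px
nth-All (suc (suc i)) (_ ∷ pxs)  = nth-All (suc i) pxs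

entry-relabel : ∀ φ T i j → entry (relabel φ T) i j ≡ Maybe.map φ (entry T i j)
entry-relabel φ T i j rewrite nth-map (map φ) i T with nth i T
... | nothing  = refl
... | just row = nth-map φ j row

entry-All : ∀ {P : ℕ → Set} {T} → All (All P) T → ∀ i j → MaybeAll.All P (entry T i j)
entry-All {T = T} T∈P i j with nth i T | nth-All i T∈P
... | nothing  | _                    = MaybeAll.nothing
... | just row | MaybeAll.just row∈P = nth-All j row∈P

countRow : ℕ → List ℕ → ℕ
countRow t row = length (filterᵇ (_≡ᵇ t) row)

module RelabelStrictlyMonotone {G : ℕ → Set} {φ : ℕ → ℕ}
  (φ-mono : ∀ {a b} → G a → G b → a < b → φ a < φ b) where

  open StrictlyMonotoneOn φ-mono

  strictRow-relabel : ∀ {row} → All G row → strictRow (map φ row) ≡ strictRow row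
  strictRow-relabel []                  = refl
  strictRow-relabel (_ ∷ [])            = refl
  strictRow-relabel (ga ∷ gb ∷ row∈G) = cong₂ _∧_ (<ᵇ-preserved ga gb) (strictRow-relabel (gb ∷ row∈G))

  cond1-relabel : ∀ {T} → All (All G) T → cond1 (relabel φ T) ≡ cond1 T
  cond1-relabel []          = refl
  cond1-relabel (r∈G ∷ T∈G) = cong₂ _∧_ (strictRow-relabel r∈G) (cond1-relabel T∈G)

  module _ {T : Filling} (T∈G : All (All G) T) where

    <∞-entry-relabel : ∀ i j k l → (entry (relabel φ T) i j <∞ entry (relabel φ T) k l) ≡ (entry T i j <∞ entry T k l)
    <∞-entry-relabel i j k l rewrite entry-relabel φ T i j | entry-relabel φ T k l =
      <∞-preserved (entry-All T∈G i j) (entry-All T∈G k l)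

    ≤∞-entry-relabel : ∀ i j k l → (entry (relabel φ T) i j ≤∞ entry (relabel φ T) k l) ≡ (entry T i j ≤∞ entry T k l)
    ≤∞-entry-relabel i j k l rewrite entry-relabel φ T i j | entry-relabel φ T k l =
      ≤∞-preserved (entry-All T∈G i j) (entry-All T∈G k l)

    cond2-relabel : ∀ α → cond2 α (relabel φ T) ≡ cond2 α T
    cond2-relabel α = all-cong (range1 (length α)) (λ i → ≤∞-entry-relabel i 1 (suc i) 1)

    cond3-relabel : ∀ α → cond3 α (relabel φ T) ≡ cond3 α T
    cond3-relabel α =
      all-cong (range1 (length α)) λ i → all-cong (range1 (length α)) λ j → all-cong (range1 (maxList α)) λ k →
        cong₂ (λ lt le → (i <ᵇ j) ⇒ᵇ ((k <ᵇ maxList α) ⇒ᵇ (lt ⇒ᵇ le)))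
          (<∞-entry-relabel j k i (suc k)) (≤∞-entry-relabel j (suc k) i (suc k))

    isSSYRT-relabel : ∀ α → isSSYRT α (relabel φ T) ≡ isSSYRT α T
    isSSYRT-relabel α = cong₂ _∧_ (cond1-relabel T∈G) (cong₂ _∧_ (cond2-relabel α) (cond3-relabel α))

  countRow-relabel : ∀ {s} → G s → ∀ {row} → All G row → countRow (φ s) (map φ row) ≡ countRow s row
  countRow-relabel gs []                         = refl
  countRow-relabel {s} gs {x ∷ row} (gx ∷ row∈G) = begin
    countRow (φ s) (map φ (x ∷ row))                    ≡⟨ length-filterᵇ-∷ (_≡ᵇ φ s) (φ x) (map φ row) ⟩
    indicator (φ x ≡ᵇ φ s) + countRow (φ s) (map φ row) ≡⟨ cong₂ (λ b n → indicator b + n) (≡ᵇ-preserved gx gs) (countRow-relabel gs row∈G) ⟩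
    indicator (x ≡ᵇ s) + countRow s row                 ≡⟨ length-filterᵇ-∷ (_≡ᵇ s) x row ⟨
    countRow s (x ∷ row)                                ∎
    where open ≡-Reasoning

  countIn-relabel : ∀ {s} → G s → ∀ {T} → All (All G) T → countIn (φ s) (relabel φ T) ≡ countIn s T
  countIn-relabel gs []          = refl
  countIn-relabel gs (r∈G ∷ T∈G) = cong₂ _+_ (countRow-relabel gs r∈G) (countIn-relabel gs T∈G)

countRow-∉ : ∀ {t row} → All (_≢ t) row → countRow t row ≡ 0
countRow-∉ {t} row≢t = cong length (filter-none (T? ∘ (_≡ᵇ t)) (All.map (λ x≢t → x≢t ∘ ≡ᵇ⇒≡ _ _) row≢t))

countIn-∉ : ∀ {t T} → All (All (_≢ t)) T → countIn t T ≡ 0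
countIn-∉ []          = refl
countIn-∉ (r≢t ∷ T≢t) = cong₂ _+_ (countRow-∉ r≢t) (countIn-∉ T≢t)

countIn-∈ : ∀ {t T} → Any (t ∈_) T → 0 < countIn t T
countIn-∈ {t} (here t∈r) =
  <-≤-trans (filter-some (T? ∘ (_≡ᵇ t)) (Any.map (λ t≡x → ≡⇒≡ᵇ _ _ (sym t≡x)) t∈r)) (m≤m+n _ _)
countIn-∈ (there t∈T) = <-≤-trans (countIn-∈ t∈T) (m≤n+m _ _)

expOf-nth : ∀ e t → expOf e t ≡ fromMaybe 0 (nth t e)
expOf-nth e t with nth t e
... | nothing = refl
... | just v  = refl

nth-≥ : ∀ {A : Set} (xs : List A) {t} → length xs ≤ t → nth (suc t) xs ≡ nothing
nth-≥ []       _            = refl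
nth-≥ (x ∷ xs) (s≤s |xs|≤t) = nth-≥ xs |xs|≤t

expOf-∉range1 : ∀ e {t} → t ∉ range1 (length e) → expOf e t ≡ 0
expOf-∉range1 e {zero}  _  = refl
expOf-∉range1 e {suc t} t∉ = trans (expOf-nth e (suc t)) (cong (fromMaybe 0) (nth-≥ e (≮⇒≥ (t∉ ∘ ∈-range1⁺))))

hasWeight⁺ : ∀ e T → (∀ t → countIn t T ≡ expOf e t) → Bool.T (hasWeight e T)
hasWeight⁺ e T weight = All.all⁻ _ (All.universal (λ t → ≡⇒≡ᵇ _ _ (weight t)) (range1 (length e)))

hasWeight⁻ : ∀ e {T} → All (All (_∈ range1 (length e))) T → Bool.T (hasWeight e T) → ∀ t → countIn t T ≡ expOf e t
hasWeight⁻ e T∈range hw t with t ∈? range1 (length e)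
... | yes t∈ = ≡ᵇ⇒≡ _ _ (All.lookup (All.all⁺ _ _ hw) t∈)
... | no  t∉ = trans (countIn-∉ (All.map (All.map (λ x∈ x≡t → t∉ (subst (_∈ _) x≡t x∈))) T∈range))
                     (sym (expOf-∉range1 e t∉))

nth-applyUpTo : ∀ {A : Set} (f : ℕ → A) {N t} → t < N → nth (suc t) (applyUpTo f N) ≡ just (f t)
nth-applyUpTo f {suc N} {zero}  _          = refl
nth-applyUpTo f {suc N} {suc t} (s≤s t<N) = nth-applyUpTo (f ∘ suc) t<N

expOf-map-range1 : ∀ (f : ℕ → ℕ) N → (∀ {t} → t ∉ range1 N → f t ≡ 0) → ∀ t → expOf (map f (range1 N)) t ≡ f t
expOf-map-range1 f N f≡0 zero = sym (f≡0 (0∉range1 N))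
expOf-map-range1 f N f≡0 (suc t) with t <? N
... | yes t<N = begin
  expOf (map f (range1 N)) (suc t)                  ≡⟨ expOf-nth (map f (range1 N)) (suc t) ⟩
  fromMaybe 0 (nth (suc t) (map f (range1 N)))      ≡⟨ cong (fromMaybe 0 ∘ nth (suc t)) f[range1]≡ ⟩
  fromMaybe 0 (nth (suc t) (applyUpTo (f ∘ suc) N)) ≡⟨ cong (fromMaybe 0) (nth-applyUpTo (f ∘ suc) t<N) ⟩
  f (suc t)                                         ∎
  where open ≡-Reasoning
        f[range1]≡ : map f (range1 N) ≡ applyUpTo (f ∘ suc) N
        f[range1]≡ = trans (cong (map f) (range1≡applyUpTo N)) (map-applyUpTo suc f N)
... | no t≮N =
  trans (expOf-nth (map f (range1 N)) (suc t))
    (trans (cong (fromMaybe 0) (nth-≥ (map f (range1 N)) (≤-trans (≤-reflexive |f[range1]|) (≮⇒≥ t≮N))))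
      (sym (f≡0 (t≮N ∘ ∈-range1⁻))))
  where |f[range1]| : length (map f (range1 N)) ≡ N
        |f[range1]| = trans (length-map f (range1 N)) (length-range1 N)

length-monomial : ∀ is γ → length (monomial is γ) ≡ maxList is
length-monomial is γ = trans (length-map (monoExp is γ) (range1 (maxList is))) (length-range1 (maxList is))

monoExp-tail : ∀ {i t} is g γ → t ≢ i → monoExp (i ∷ is) (g ∷ γ) t ≡ monoExp is γ t
monoExp-tail {i} {t} is g γ t≢i = cong (λ b → (if b then g else 0) + monoExp is γ t) (≢⇒≡ᵇ-false (t≢i ∘ sym))

monoExp-∉ : ∀ is γ {t} → t ∉ is → monoExp is γ t ≡ 0
monoExp-∉ []       γ       _  = refl
monoExp-∉ (i ∷ is) []      _  = refl
monoExp-∉ (i ∷ is) (g ∷ γ) t∉ = trans (monoExp-tail is g γ (t∉ ∘ here)) (monoExp-∉ is γ (t∉ ∘ there))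

monoExp-head : ∀ {i} is g γ → StrictlyIncreasingPos (i ∷ is) → monoExp (i ∷ is) (g ∷ γ) i ≡ g
monoExp-head {i} is g γ ↑ =
  trans (cong₂ (λ b n → (if b then g else 0) + n) (≡ᵇ-refl i) (monoExp-∉ is γ (Increasing-head∉ ↑))) (+-identityʳ g)

expOf-monomial : ∀ {is} γ → StrictlyIncreasingPos is → ∀ t → expOf (monomial is γ) t ≡ monoExp is γ t
expOf-monomial {is} γ ↑ = expOf-map-range1 (monoExp is γ) (maxList is) (λ t∉ → monoExp-∉ is γ (t∉ ∘ Increasing-⊆-range1 ↑))

monoExp-reindex : ∀ is js γ → length is ≡ length js → StrictlyIncreasingPos is → StrictlyIncreasingPos js →
  ∀ {s} → s ∈ is → monoExp is γ s ≡ monoExp js γ (reindex is js s)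
monoExp-reindex (i ∷ is) (j ∷ js) []      _ _ _ _ = refl
monoExp-reindex (i ∷ is) (j ∷ js) (g ∷ γ) _ is↑ js↑ (here refl) =
  trans (monoExp-head is g γ is↑) (sym (trans (cong (monoExp (j ∷ js) (g ∷ γ)) (reindex-head i is j js)) (monoExp-head js g γ js↑)))
monoExp-reindex (i ∷ is) (j ∷ js) (g ∷ γ) |is| is↑ js↑ {s} (there s∈) = begin
  monoExp (i ∷ is) (g ∷ γ) s                              ≡⟨ monoExp-tail is g γ (Increasing-tail-≢ is↑ s∈) ⟩
  monoExp is γ s                                          ≡⟨ monoExp-reindex is js γ |is|′ (Increasing-tail is↑) (Increasing-tail js↑) s∈ ⟩
  monoExp js γ (reindex is js s)                          ≡⟨ monoExp-tail js g γ (Increasing-tail-≢ js↑ (reindex-∈ is js |is|′ (Increasing-tail is↑) s∈)) ⟨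
  monoExp (j ∷ js) (g ∷ γ) (reindex is js s)              ≡⟨ cong (monoExp (j ∷ js) (g ∷ γ)) (reindex-tail (Increasing-tail-≢ is↑ s∈)) ⟨
  monoExp (j ∷ js) (g ∷ γ) (reindex (i ∷ is) (j ∷ js) s) ∎
  where open ≡-Reasoning
        |is|′ : length is ≡ length js
        |is|′ = suc-injective |is|

-- Total weight

sum-map-+ : ∀ (f g : ℕ → ℕ) xs → sum (map (λ t → f t + g t) xs) ≡ sum (map f xs) + sum (map g xs)
sum-map-+ f g []       = refl
sum-map-+ f g (x ∷ xs) = trans (cong (f x + g x +_) (sum-map-+ f g xs)) (interchange (f x) (g x) _ _)

sum-map-0 : ∀ {A : Set} (xs : List A) → sum (map (λ _ → 0) xs) ≡ 0
sum-map-0 []       = refl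
sum-map-0 (_ ∷ xs) = sum-map-0 xs

sum-indicator-∉ : ∀ {x} R → x ∉ R → sum (map (λ t → indicator (x ≡ᵇ t)) R) ≡ 0
sum-indicator-∉ []      _   = refl
sum-indicator-∉ (t ∷ R) x∉ = cong₂ (λ b n → indicator b + n) (≢⇒≡ᵇ-false (x∉ ∘ here)) (sum-indicator-∉ R (x∉ ∘ there))

sum-indicator-∈ : ∀ {x R} → Unique R → x ∈ R → sum (map (λ t → indicator (x ≡ᵇ t)) R) ≡ 1
sum-indicator-∈ {x} {_ ∷ R} (x∉R ∷ _)  (here refl) =
  cong₂ (λ b n → indicator b + n) (≡ᵇ-refl x) (sum-indicator-∉ R (λ x∈ → All.lookup x∉R x∈ refl))
sum-indicator-∈ (t∉R ∷ !R) (there x∈) =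
  cong₂ (λ b n → indicator b + n) (≢⇒≡ᵇ-false (λ x≡t → All.lookup t∉R x∈ (sym x≡t))) (sum-indicator-∈ !R x∈)

sum-countRow : ∀ {R} → Unique R → ∀ {row} → All (_∈ R) row → sum (map (λ t → countRow t row) R) ≡ length row
sum-countRow {R} !R []                        = sum-map-0 R
sum-countRow {R} !R {x ∷ row} (x∈ ∷ row∈R) = begin
  sum (map (λ t → countRow t (x ∷ row)) R)                                       ≡⟨ cong sum (map-cong (λ t → length-filterᵇ-∷ (_≡ᵇ t) x row) R) ⟩
  sum (map (λ t → indicator (x ≡ᵇ t) + countRow t row) R)                        ≡⟨ sum-map-+ _ _ R ⟩
  sum (map (λ t → indicator (x ≡ᵇ t)) R) + sum (map (λ t → countRow t row) R) ≡⟨ cong₂ _+_ (sum-indicator-∈ !R x∈) (sum-countRow !R row∈R) ⟩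
  suc (length row)                                                                ∎
  where open ≡-Reasoning

sum-countIn : ∀ {R} → Unique R → ∀ {T} → All (All (_∈ R)) T → sum (map (λ t → countIn t T) R) ≡ sum (map length T)
sum-countIn {R} !R []          = sum-map-0 R
sum-countIn {R} !R (r∈R ∷ T∈R) =
  trans (sum-map-+ _ _ R) (cong₂ _+_ (sum-countRow !R r∈R) (sum-countIn !R T∈R))

applyUpTo-expOf : ∀ e (f : ℕ → ℕ) → (∀ i → f i ≡ expOf e (suc i)) → applyUpTo f (length e) ≡ e
applyUpTo-expOf []      f f≗ = refl
applyUpTo-expOf (x ∷ e) f f≗ =
  cong₂ _∷_ (f≗ 0) (applyUpTo-expOf e (f ∘ suc) (λ i → trans (f≗ (suc i)) (expOf-∷ i)))
  where
  expOf-∷ : ∀ i → expOf (x ∷ e) (suc (suc i)) ≡ expOf e (suc i)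
  expOf-∷ i = trans (expOf-nth (x ∷ e) (suc (suc i))) (sym (expOf-nth e (suc i)))

map-expOf-range1 : ∀ e → map (expOf e) (range1 (length e)) ≡ e
map-expOf-range1 e =
  trans (cong (map (expOf e)) (range1≡applyUpTo (length e)))
    (trans (map-applyUpTo suc (expOf e) (length e)) (applyUpTo-expOf e (expOf e ∘ suc) (λ _ → refl)))

weight-degree : ∀ {α e T} → HasShape α T → All (All (_∈ range1 (length e))) T →
  (∀ t → countIn t T ≡ expOf e t) → sum e ≡ sum α
weight-degree {e = e} {T} refl T∈range weight = begin
  sum e                                               ≡⟨ cong sum (map-expOf-range1 e) ⟨
  sum (map (expOf e) (range1 (length e)))             ≡⟨ cong sum (map-cong (sym ∘ weight) (range1 (length e))) ⟩
  sum (map (λ t → countIn t T) (range1 (length e)))   ≡⟨ sum-countIn (range1-Unique (length e)) T∈range ⟩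
  sum (map length T)                                  ∎
  where open ≡-Reasoning

SSYRTsOfWeight : List ℕ → List ℕ → List Filling
SSYRTsOfWeight α e = filterᵇ (λ T → isSSYRT α T ∧ hasWeight e T) (fillings α (length e))

record IsSSYRTOfWeight (α e : List ℕ) (T : Filling) : Set where
  field
    shape   : HasShape α T
    ssyrt   : Bool.T (isSSYRT α T)
    entries : All (All (_∈ range1 (length e))) T
    weight  : ∀ t → countIn t T ≡ expOf e t

∈-SSYRTsOfWeight⁻ : ∀ α e {T} → T ∈ SSYRTsOfWeight α e → IsSSYRTOfWeight α e T
∈-SSYRTsOfWeight⁻ α e T∈ with ∈-filter⁻ (T? ∘ _) T∈
... | T∈fillings , ok with ∈-fillings⁻ α (length e) T∈fillings | Equivalence.to T-∧ ok
...   | shape , entries | ssyrt , hw = record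
  { shape = shape ; ssyrt = ssyrt ; entries = entries ; weight = hasWeight⁻ e entries hw }

∈-SSYRTsOfWeight⁺ : ∀ α e {T} → IsSSYRTOfWeight α e T → T ∈ SSYRTsOfWeight α e
∈-SSYRTsOfWeight⁺ α e {T} T-ok = ∈-filter⁺ (T? ∘ _) (∈-fillings⁺ α (length e) shape entries)
  (Equivalence.from T-∧ (ssyrt , hasWeight⁺ e T weight))
  where open IsSSYRTOfWeight T-ok

SSYRTsOfWeight-Unique : ∀ α e → Unique (SSYRTsOfWeight α e)
SSYRTsOfWeight-Unique α e = Unique.filter⁺ (T? ∘ _) (fillings-Unique α (length e))

∉⇒length≡0 : ∀ {A : Set} (xs : List A) → (∀ {x} → x ∉ xs) → length xs ≡ 0
∉⇒length≡0 []       _   = refl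
∉⇒length≡0 (x ∷ xs) ∉xs = ⊥-elim (∉xs (here refl))

coeffR-degree : ∀ α e → sum α < sum e → coeffR α e ≡ 0
coeffR-degree α e |α|<|e| = ∉⇒length≡0 (SSYRTsOfWeight α e) λ T∈ →
  let open IsSSYRTOfWeight (∈-SSYRTsOfWeight⁻ α e T∈)
  in <-irrefl (sym (weight-degree shape entries weight)) |α|<|e|

Any-entry⇒All : ∀ {P : ℕ → Set} {T : Filling} → (∀ {x} → Any (x ∈_) T → P x) → All (All P) T
Any-entry⇒All P-entry = All.tabulate (λ row∈ → All.tabulate (λ x∈ → P-entry (Any.map (λ { refl → x∈ }) row∈)))

All-relabel : ∀ {P Q : ℕ → Set} φ → (∀ {x} → P x → Q (φ x)) → ∀ {T} → All (All P) T → All (All Q) (relabel φ T)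
All-relabel φ P⇒Qφ T∈P = All.map⁺ (All.map (All.map⁺ ∘ All.map P⇒Qφ) T∈P)

weight-support : ∀ is γ {T} → (∀ t → countIn t T ≡ monoExp is γ t) → All (All (_∈ is)) T
weight-support is γ {T} weight = Any-entry⇒All support
  where
  support : ∀ {x} → Any (x ∈_) T → x ∈ is
  support {x} x∈T with x ∈? is
  ... | yes x∈is = x∈is
  ... | no  x∉is = ⊥-elim (<-irrefl (sym (trans (weight x) (monoExp-∉ is γ x∉is))) (countIn-∈ x∈T))

monomial-weight : ∀ {α is γ T} → StrictlyIncreasingPos is → IsSSYRTOfWeight α (monomial is γ) T →
  ∀ t → countIn t T ≡ monoExp is γ t
monomial-weight {γ = γ} is↑ T-ok t = trans (weight t) (expOf-monomial γ is↑ t)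
  where open IsSSYRTOfWeight T-ok

module _ {is js : List ℕ} (|is| : length is ≡ length js)
         (is↑ : StrictlyIncreasingPos is) (js↑ : StrictlyIncreasingPos js) where

  private
    φ ψ : ℕ → ℕ
    φ = reindex is js
    ψ = reindex js is

  open RelabelStrictlyMonotone (reindex-mono is js |is| is↑ js↑)

  relabel-weight : ∀ γ {T} → All (All (_∈ is)) T → (∀ t → countIn t T ≡ monoExp is γ t) →
    ∀ t → countIn t (relabel φ T) ≡ monoExp js γ t
  relabel-weight γ {T} T∈is weight t with t ∈? js
  ... | yes t∈js = begin
    countIn t (relabel φ T)          ≡⟨ cong (λ u → countIn u (relabel φ T)) φψt≡t ⟨
    countIn (φ (ψ t)) (relabel φ T)  ≡⟨ countIn-relabel ψt∈is T∈is ⟩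
    countIn (ψ t) T                  ≡⟨ weight (ψ t) ⟩
    monoExp is γ (ψ t)               ≡⟨ monoExp-reindex is js γ |is| is↑ js↑ ψt∈is ⟩
    monoExp js γ (φ (ψ t))           ≡⟨ cong (monoExp js γ) φψt≡t ⟩
    monoExp js γ t                   ∎
    where
    open ≡-Reasoning
    ψt∈is : ψ t ∈ is
    ψt∈is = reindex-∈ js is (sym |is|) js↑ t∈js
    φψt≡t : φ (ψ t) ≡ t
    φψt≡t = reindex-inverse js is (sym |is|) js↑ is↑ t∈js
  ... | no t∉js = trans (countIn-∉ (All-relabel φ φx≢t T∈is)) (sym (monoExp-∉ js γ t∉js))
    where
    φx≢t : ∀ {x} → x ∈ is → φ x ≢ t
    φx≢t x∈ φx≡t = t∉js (subst (_∈ js) φx≡t (reindex-∈ is js |is| is↑ x∈))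

  relabel-IsSSYRTOfWeight : ∀ α γ {T} → IsSSYRTOfWeight α (monomial is γ) T → IsSSYRTOfWeight α (monomial js γ) (relabel φ T)
  relabel-IsSSYRTOfWeight α γ {T} T-ok = record
    { shape   = relabel-HasShape φ T shape
    ; ssyrt   = subst Bool.T (sym (isSSYRT-relabel T∈is α)) ssyrt
    ; entries = All-relabel φ (js⊆range ∘ reindex-∈ is js |is| is↑) T∈is
    ; weight  = λ t → trans (relabel-weight γ T∈is (monomial-weight is↑ T-ok) t) (sym (expOf-monomial γ js↑ t))
    }
    where
    open IsSSYRTOfWeight T-ok
    T∈is : All (All (_∈ is)) T
    T∈is = weight-support is γ (monomial-weight is↑ T-ok)
    js⊆range : js ⊆ range1 (length (monomial js γ))
    js⊆range = subst (λ N → _ ∈ range1 N) (sym (length-monomial js γ)) ∘ Increasing-⊆-range1 js↑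

  coeffR-reindex-≤ : ∀ α γ → coeffR α (monomial is γ) ≤ coeffR α (monomial js γ)
  coeffR-reindex-≤ α γ =
    length-≤-retraction (relabel φ) (relabel ψ) (SSYRTsOfWeight-Unique α (monomial is γ))
      (∈-SSYRTsOfWeight⁺ α (monomial js γ) ∘ relabel-IsSSYRTOfWeight α γ ∘ ∈-SSYRTsOfWeight⁻ α (monomial is γ))
      (relabel-inverse φ ψ (reindex-inverse is js |is| is↑ js↑) ∘ T∈is)
    where
    T∈is : ∀ {T} → T ∈ SSYRTsOfWeight α (monomial is γ) → All (All (_∈ is)) T
    T∈is = weight-support is γ ∘ monomial-weight is↑ ∘ ∈-SSYRTsOfWeight⁻ α (monomial is γ)

corollary1 : (α : List ℕ) → IsComposition α → IsQuasisymmetric (coeffR α)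
corollary1 α _ =
  (sum α , coeffR-degree α) ,
  λ γ _ is js |is| |js| is↑ js↑ →
    let |is|≡|js| = trans |is| (sym |js|)
    in ≤-antisym (coeffR-reindex-≤ |is|≡|js| is↑ js↑ α γ) (coeffR-reindex-≤ (sym |is|≡|js|) js↑ is↑ α γ)
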